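{- Let $t$ be an even positive integer and $\pi$ any partition. Define $n_i=r_i(\pi,t)-r_{i+1}(\pi,t)$ for $0\le i\le t-2$. Then $$\mathrm{BG\text{ - }rank}(\pi)=\sum_{i=0}^{\frac{t-2}{2}} n_{2i}.$$
   Context: For a partition $\pi=(\lambda_1\ge\lambda_2\ge\cdots)$ (with $\lambda_i=0$ beyond the number of parts), $\mathrm{BG\text{ - }rank}(\pi)=\sum_{j\ge1}(-1)^{j+1}\frac{1-(-1)^{\lambda_j}}{2}$. The $t$-residue diagram of $\pi$ labels the cell in row $i$ and column $j$ of the Young diagram by the least nonnegative integer congruent to $j-i$ modulo $t$; $r_i(\pi,t)$ is the number of cells labelled $i$. -}

module Defs where

open import Data.Nat as ℕ using (ℕ; zero; suc; _≥_; _∸_; NonZero)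
open import Data.Integer as ℤ using (ℤ; +_; _-_; _+_)
open import Data.Integer using (_%ℕ_)
open import Data.List using (List; []; _∷_; upTo; map; sum; length; filter)
open import Data.List.Relation.Unary.All using (All)
open import Data.List.Relation.Unary.Linked using (Linked)
open import Relation.Nullary.Decidable using (⌊_⌋)

IsPartition : List ℕ → Set
IsPartition λs = Linked _≥_ λs × All NonZero λs
  where open import Data.Product using (_×_)

oddBit : ℕ → ℤ
oddBit n = + (n ℕ.% 2)

-- BG-rank: Σ_{j≥1} (-1)^{j+1} (1 - (-1)^{λ_j})/2 ; rows beyond the parts contribute 0.
-- bgFrom s λs : s = true means the current row index j is odd (sign +).
bgFrom : ℕ → List ℕ → ℤ
bgFrom j [] = + 0
bgFrom j (l ∷ ls) with j ℕ.% 2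
... | 1 = oddBit l + bgFrom (suc j) ls
... | _ = (+ 0 - oddBit l) + bgFrom (suc j) ls

BGrank : List ℕ → ℤ
BGrank λs = bgFrom 1 λs

-- residue of cell (row i, column j), 1-indexed: least nonneg integer ≡ j - i mod t
residue : (t : ℕ) .{{_ : NonZero t}} → ℕ → ℕ → ℕ
residue t i j = ((+ j) - (+ i)) %ℕ t

rowCount : (t : ℕ) .{{_ : NonZero t}} → ℕ → ℕ → ℕ → ℕ
rowCount t a i l = length (filter (λ j → residue t i (suc j) ℕ.≟ a) (upTo l))

countFrom : (t : ℕ) .{{_ : NonZero t}} → ℕ → ℕ → List ℕ → ℕ
countFrom t a i [] = 0
countFrom t a i (l ∷ ls) = rowCount t a i l ℕ.+ countFrom t a (suc i) ls

r : ℕ → (t : ℕ) .{{_ : NonZero t}} → List ℕ → ℕ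
r a t λs = countFrom t a 1 λs

nDiff : (t : ℕ) .{{_ : NonZero t}} → List ℕ → ℕ → ℤ
nDiff t λs a = (+ r a t λs) - (+ r (suc a) t λs)

sumℤ : ℕ → (ℕ → ℤ) → ℤ
sumℤ zero f = + 0
sumℤ (suc m) f = sumℤ m f + f m

-- For even t the residue of the cell (i, j) has the parity of i + j, so
-- Σₖ n₂ₖ = Σₖ (r₂ₖ − r₂ₖ₊₁) counts every cell (i, j) with the sign (−1)^(i+j).
-- Row i of length λᵢ therefore contributes Σ_{j ≤ λᵢ} (−1)^(i+j) = (−1)^(i+1) (λᵢ mod 2),
-- which is exactly its term in the BG-rank.
module Submission where

open import Defs
open import Data.Nat using (ℕ; NonZero; _*_; _/_)
open import Data.Nat.Divisibility using (_∣_)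
open import Data.List using (List)
open import Relation.Binary.PropositionalEquality using (_≡_)

open import Data.Bool using (true; false; if_then_else_)
open import Data.Integer as ℤ using (ℤ; +_; -_; _+_; _-_; 1ℤ; -1ℤ; ∣_∣; _%ℕ_; _/ℕ_)
open import Data.Integer.DivMod using (a≡a%ℕn+[a/ℕn]*n; n%ℕd<d)
import Data.Integer.Properties as ℤₚ
open import Data.Integer.Tactic.RingSolver using (solve-∀)
open import Data.List using ([]; _∷_; [_]; _++_; filter; length; upTo)
open import Data.List.Properties using (upTo-∷ʳ; filter-++; length-++)
open import Data.Nat as ℕ using (zero; suc; _<_; _%_; s≤s)
open import Data.Nat.Divisibility using (divides)
open import Data.Nat.DivMod using (m%n<n; m*n/n≡m)
import Data.Nat.Properties as ℕₚ
open import Function using (_∘_)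
open import Relation.Binary.PropositionalEquality using (refl; sym; trans; cong; cong₂; subst; module ≡-Reasoning)
open import Relation.Nullary using (does)
open import Relation.Unary using (Pred; Decidable)

open ≡-Reasoning

sign : ℕ → ℤ
sign zero = 1ℤ
sign (suc zero) = -1ℤ
sign (suc (suc n)) = sign n

sign-suc : ∀ n → sign (suc n) ≡ - sign n
sign-suc zero = refl
sign-suc (suc n) = sym (trans (cong -_ (sign-suc n)) (ℤₚ.neg-involutive (sign n)))

sign[1+n]≡-sign[n%2] : ∀ n → sign (suc n) ≡ - sign (n % 2)
sign[1+n]≡-sign[n%2] zero = refl
sign[1+n]≡-sign[n%2] (suc zero) = refl
sign[1+n]≡-sign[n%2] (suc (suc n)) = sign[1+n]≡-sign[n%2] n

sign[n*2]≡1 : ∀ n → sign (n * 2) ≡ 1ℤ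
sign[n*2]≡1 zero = refl
sign[n*2]≡1 (suc n) = sign[n*2]≡1 n

2∣m+n⇒sign[m]≡sign[n] : ∀ m n → 2 ∣ m ℕ.+ n → sign m ≡ sign n
2∣m+n⇒sign[m]≡sign[n] zero n (divides q n≡q*2) =
  trans (sym (sign[n*2]≡1 q)) (cong sign (sym n≡q*2))
2∣m+n⇒sign[m]≡sign[n] (suc m) n 2∣1+m+n = begin
  sign (suc m)   ≡⟨ sign-suc m ⟩
  - sign m       ≡⟨ cong -_ (2∣m+n⇒sign[m]≡sign[n] m (suc n) 2∣m+1+n) ⟩
  - sign (suc n) ≡⟨ cong -_ (sign-suc n) ⟩
  - - sign n     ≡⟨ ℤₚ.neg-involutive (sign n) ⟩
  sign n         ∎
  where
  2∣m+1+n : 2 ∣ m ℕ.+ suc n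
  2∣m+1+n = subst (2 ∣_) (sym (ℕₚ.+-suc m n)) 2∣1+m+n

sumℤ-cong : ∀ h {f g : ℕ → ℤ} → (∀ k → f k ≡ g k) → sumℤ h f ≡ sumℤ h g
sumℤ-cong zero    f≗g = refl
sumℤ-cong (suc h) f≗g = cong₂ _+_ (sumℤ-cong h f≗g) (f≗g h)

sumℤ-zero : ∀ h → sumℤ h (λ _ → + 0) ≡ + 0
sumℤ-zero zero    = refl
sumℤ-zero (suc h) = trans (ℤₚ.+-identityʳ _) (sumℤ-zero h)

sumℤ-+ : ∀ h (f g : ℕ → ℤ) → sumℤ h (λ k → f k + g k) ≡ sumℤ h f + sumℤ h g
sumℤ-+ zero    f g = refl
sumℤ-+ (suc h) f g =
  trans (cong (_+ (f h + g h)) (sumℤ-+ h f g)) (interchange (sumℤ h f) (sumℤ h g) (f h) (g h))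
  where
  interchange : ∀ a b c d → (a + b) + (c + d) ≡ (a + c) + (b + d)
  interchange = solve-∀

sumℤ-shift : ∀ h (f : ℕ → ℤ) → sumℤ (suc h) f ≡ f 0 + sumℤ h (f ∘ suc)
sumℤ-shift zero    f = ℤₚ.+-comm (+ 0) (f 0)
sumℤ-shift (suc h) f = trans (cong (_+ f (suc h)) (sumℤ-shift h f)) (ℤₚ.+-assoc (f 0) _ _)

sumℤ-sign : ∀ m l → sumℤ l (λ c → sign (m ℕ.+ c)) ≡ sign m ℤ.* oddBit l
sumℤ-sign m zero = sym (ℤₚ.*-zeroʳ (sign m))
sumℤ-sign m (suc zero) = begin
  + 0 + sign (m ℕ.+ 0) ≡⟨ ℤₚ.+-identityˡ _ ⟩
  sign (m ℕ.+ 0)       ≡⟨ cong sign (ℕₚ.+-identityʳ m) ⟩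
  sign m               ≡⟨ ℤₚ.*-identityʳ (sign m) ⟨
  sign m ℤ.* 1ℤ        ∎
sumℤ-sign m (suc (suc l)) = begin
  S + sign (m ℕ.+ l) + sign (m ℕ.+ suc l) ≡⟨ cong (_+_ (S + sign (m ℕ.+ l))) sign[m+1+l] ⟩
  S + sign (m ℕ.+ l) - sign (m ℕ.+ l)     ≡⟨ cancel S (sign (m ℕ.+ l)) ⟩
  S                                       ≡⟨ sumℤ-sign m l ⟩
  sign m ℤ.* oddBit l                     ∎
  where
  S = sumℤ l (λ c → sign (m ℕ.+ c))
  sign[m+1+l] : sign (m ℕ.+ suc l) ≡ - sign (m ℕ.+ l)
  sign[m+1+l] = trans (cong sign (ℕₚ.+-suc m l)) (sign-suc (m ℕ.+ l))
  cancel : ∀ a b → a + b - b ≡ a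
  cancel = solve-∀

bgFrom-∷ : ∀ j l ls → bgFrom j (l ∷ ls) ≡ sign (suc j) ℤ.* oddBit l + bgFrom (suc j) ls
bgFrom-∷ j l ls with j % 2 | m%n<n j 2 | sign[1+n]≡-sign[n%2] j
... | 0 | _ | sign[1+j] = cong (_+ bgFrom (suc j) ls) (begin
  + 0 - oddBit l            ≡⟨ ℤₚ.+-identityˡ (- oddBit l) ⟩
  - oddBit l                ≡⟨ ℤₚ.-1*i≡-i (oddBit l) ⟨
  -1ℤ ℤ.* oddBit l          ≡⟨ cong (ℤ._* oddBit l) sign[1+j] ⟨
  sign (suc j) ℤ.* oddBit l ∎)
... | 1 | _ | sign[1+j] = cong (_+ bgFrom (suc j) ls) (begin
  oddBit l                  ≡⟨ ℤₚ.*-identityˡ (oddBit l) ⟨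
  1ℤ ℤ.* oddBit l           ≡⟨ cong (ℤ._* oddBit l) sign[1+j] ⟨
  sign (suc j) ℤ.* oddBit l ∎)
... | suc (suc _) | s≤s (s≤s ()) | _

indicator : ℕ → ℕ → ℕ
indicator x a = if does (x ℕ.≟ a) then 1 else 0

length-filter-[x] : ∀ {a p} {A : Set a} {P : Pred A p} (P? : Decidable P) x →
                    length (filter P? [ x ]) ≡ (if does (P? x) then 1 else 0)
length-filter-[x] P? x with does (P? x)
... | true  = refl
... | false = refl

rowCount-suc : ∀ t .{{_ : NonZero t}} a i l →
               rowCount t a i (suc l) ≡ rowCount t a i l ℕ.+ indicator (residue t i (suc l)) a
rowCount-suc t a i l = begin
  length (filter P? (upTo (suc l)))              ≡⟨ cong (length ∘ filter P?) (upTo-∷ʳ l) ⟨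
  length (filter P? (upTo l ++ [ l ]))           ≡⟨ cong length (filter-++ P? (upTo l) [ l ]) ⟩
  length (filter P? (upTo l) ++ filter P? [ l ]) ≡⟨ length-++ (filter P? (upTo l)) ⟩
  rowCount t a i l ℕ.+ length (filter P? [ l ])  ≡⟨ cong (rowCount t a i l ℕ.+_) (length-filter-[x] P? l) ⟩
  rowCount t a i l ℕ.+ indicator (residue t i (suc l)) a ∎
  where
  P? = λ j → residue t i (suc j) ℕ.≟ a

alternatingSum : (ℕ → ℕ) → ℕ → ℤ
alternatingSum c h = sumℤ h (λ k → + c (2 * k) - + c (suc (2 * k)))

alternatingSum-cong : ∀ h {c d : ℕ → ℕ} → (∀ a → c a ≡ d a) → alternatingSum c h ≡ alternatingSum d h
alternatingSum-cong h c≗d =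
  sumℤ-cong h (λ k → cong₂ (λ p q → + p - + q) (c≗d (2 * k)) (c≗d (suc (2 * k))))

alternatingSum-0 : ∀ h → alternatingSum (λ _ → 0) h ≡ + 0
alternatingSum-0 = sumℤ-zero

alternatingSum-+ : ∀ h (c d : ℕ → ℕ) →
                   alternatingSum (λ a → c a ℕ.+ d a) h ≡ alternatingSum c h + alternatingSum d h
alternatingSum-+ h c d = trans
  (sumℤ-cong h λ k → split (c (2 * k)) (d (2 * k)) (c (suc (2 * k))) (d (suc (2 * k))))
  (sumℤ-+ h _ _)
  where
  split : ∀ a b a′ b′ → + (a ℕ.+ b) - + (a′ ℕ.+ b′) ≡ (+ a - + a′) + (+ b - + b′)
  split a b a′ b′ = begin
    + (a ℕ.+ b) - + (a′ ℕ.+ b′)     ≡⟨ cong₂ _-_ (ℤₚ.pos-+ a b) (ℤₚ.pos-+ a′ b′) ⟩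
    (+ a + + b) - (+ a′ + + b′)     ≡⟨ interchange (+ a) (+ b) (+ a′) (+ b′) ⟩
    (+ a - + a′) + (+ b - + b′)     ∎
    where
    interchange : ∀ x y x′ y′ → (x + y) - (x′ + y′) ≡ (x - x′) + (y - y′)
    interchange = solve-∀

alternatingSum-shift : ∀ h c → alternatingSum c (suc h) ≡ (+ c 0 - + c 1) + alternatingSum (c ∘ suc ∘ suc) h
alternatingSum-shift h c = trans (sumℤ-shift h _) (cong (_+_ (+ c 0 - + c 1))
  (sumℤ-cong h λ k → cong (λ m → + c m - + c (suc m)) (ℕₚ.*-suc 2 k)))

alternatingSum-indicator : ∀ x h → x < h * 2 → alternatingSum (indicator x) h ≡ sign x
alternatingSum-indicator zero (suc h) _ =
  trans (alternatingSum-shift h (indicator 0)) (cong (_+_ 1ℤ) (alternatingSum-0 h))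
alternatingSum-indicator (suc zero) (suc h) _ =
  trans (alternatingSum-shift h (indicator 1)) (cong (_+_ -1ℤ) (alternatingSum-0 h))
alternatingSum-indicator (suc (suc x)) (suc h) (s≤s (s≤s x<h*2)) = begin
  alternatingSum (indicator (suc (suc x))) (suc h) ≡⟨ alternatingSum-shift h (indicator (suc (suc x))) ⟩
  + 0 + alternatingSum (indicator x) h             ≡⟨ ℤₚ.+-identityˡ _ ⟩
  alternatingSum (indicator x) h                   ≡⟨ alternatingSum-indicator x h x<h*2 ⟩
  sign x                                           ∎

module _ {t h : ℕ} .{{_ : NonZero t}} (t≡h*2 : t ≡ h * 2) where

  sign-residue : ∀ i j → sign (residue t i j) ≡ sign (i ℕ.+ j)
  sign-residue i j = 2∣m+n⇒sign[m]≡sign[n] (residue t i j) (i ℕ.+ j) (divides ∣ w ∣ residue+i+j≡∣w∣*2)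
    where
    z = + j - + i
    q = z /ℕ t
    -- z = residue + q t and t = 2 h give residue + i + j = 2 (j − q h).
    w = + j - q ℤ.* + h
    z≡r+q*h*2 : z ≡ + (z %ℕ t) + q ℤ.* (+ h ℤ.* + 2)
    z≡r+q*h*2 = trans (a≡a%ℕn+[a/ℕn]*n z t)
                      (cong (λ u → + (z %ℕ t) + q ℤ.* u) (trans (cong +_ t≡h*2) (ℤₚ.pos-* h 2)))
    rearrange : ∀ r q h i j → r + (i + j) ≡ (j - q ℤ.* h) ℤ.* + 2 + ((r + q ℤ.* (h ℤ.* + 2)) - (j - i))
    rearrange = solve-∀
    residue+i+j≡w*2 : + (residue t i j ℕ.+ (i ℕ.+ j)) ≡ w ℤ.* + 2
    residue+i+j≡w*2 = begin
      + (z %ℕ t ℕ.+ (i ℕ.+ j))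
        ≡⟨ trans (ℤₚ.pos-+ (z %ℕ t) (i ℕ.+ j)) (cong (_+_ (+ (z %ℕ t))) (ℤₚ.pos-+ i j)) ⟩
      + (z %ℕ t) + (+ i + + j)
        ≡⟨ rearrange (+ (z %ℕ t)) q (+ h) (+ i) (+ j) ⟩
      w ℤ.* + 2 + ((+ (z %ℕ t) + q ℤ.* (+ h ℤ.* + 2)) - z)
        ≡⟨ cong (λ u → w ℤ.* + 2 + (u - z)) z≡r+q*h*2 ⟨
      w ℤ.* + 2 + (z - z)
        ≡⟨ cong (_+_ (w ℤ.* + 2)) (ℤₚ.+-inverseʳ z) ⟩
      w ℤ.* + 2 + + 0
        ≡⟨ ℤₚ.+-identityʳ _ ⟩
      w ℤ.* + 2 ∎
    residue+i+j≡∣w∣*2 : residue t i j ℕ.+ (i ℕ.+ j) ≡ ∣ w ∣ * 2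
    residue+i+j≡∣w∣*2 = trans (cong ∣_∣ residue+i+j≡w*2) (ℤₚ.abs-* w (+ 2))

  alternatingSum-rowCount : ∀ i l →
                            alternatingSum (λ a → rowCount t a i l) h ≡ sumℤ l (λ c → sign (suc i ℕ.+ c))
  alternatingSum-rowCount i zero = alternatingSum-0 h
  alternatingSum-rowCount i (suc l) = begin
    alternatingSum (λ a → rowCount t a i (suc l)) h
      ≡⟨ alternatingSum-cong h (λ a → rowCount-suc t a i l) ⟩
    alternatingSum (λ a → rowCount t a i l ℕ.+ indicator x a) h
      ≡⟨ alternatingSum-+ h (λ a → rowCount t a i l) (indicator x) ⟩
    alternatingSum (λ a → rowCount t a i l) h + alternatingSum (indicator x) h
      ≡⟨ cong₂ _+_ (alternatingSum-rowCount i l) (alternatingSum-indicator x h x<h*2) ⟩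
    sumℤ l (λ c → sign (suc i ℕ.+ c)) + sign x
      ≡⟨ cong (_+_ (sumℤ l (λ c → sign (suc i ℕ.+ c)))) sign[x]≡sign[1+i+l] ⟩
    sumℤ (suc l) (λ c → sign (suc i ℕ.+ c)) ∎
    where
    x = residue t i (suc l)
    x<h*2 : x < h * 2
    x<h*2 = subst (x <_) t≡h*2 (n%ℕd<d (+ suc l - + i) t)
    sign[x]≡sign[1+i+l] : sign x ≡ sign (suc i ℕ.+ l)
    sign[x]≡sign[1+i+l] = trans (sign-residue i (suc l)) (cong sign (ℕₚ.+-suc i l))

  alternatingSum-countFrom : ∀ i π → alternatingSum (λ a → countFrom t a i π) h ≡ bgFrom i π
  alternatingSum-countFrom i [] = alternatingSum-0 h
  alternatingSum-countFrom i (l ∷ ls) = begin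
    alternatingSum (λ a → countFrom t a i (l ∷ ls)) h
      ≡⟨ alternatingSum-+ h (λ a → rowCount t a i l) (λ a → countFrom t a (suc i) ls) ⟩
    alternatingSum (λ a → rowCount t a i l) h + alternatingSum (λ a → countFrom t a (suc i) ls) h
      ≡⟨ cong₂ _+_ (trans (alternatingSum-rowCount i l) (sumℤ-sign (suc i) l))
                   (alternatingSum-countFrom (suc i) ls) ⟩
    sign (suc i) ℤ.* oddBit l + bgFrom (suc i) ls
      ≡⟨ bgFrom-∷ i l ls ⟨
    bgFrom i (l ∷ ls) ∎

mainTheorem5 : (t : ℕ) .{{_ : NonZero t}} → 2 ∣ t →
    (π : List ℕ) → IsPartition π →
    BGrank π ≡ sumℤ (t / 2) (λ i → nDiff t π (2 * i))
mainTheorem5 t (divides h t≡h*2) π _ = begin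
  BGrank π                                 ≡⟨ alternatingSum-countFrom {h = h} t≡h*2 1 π ⟨
  alternatingSum (λ a → r a t π) h         ≡⟨ cong (alternatingSum (λ a → r a t π)) t/2≡h ⟨
  sumℤ (t / 2) (λ i → nDiff t π (2 * i))   ∎
  where
  t/2≡h : t / 2 ≡ h
  t/2≡h = trans (cong (_/ 2) t≡h*2) (m*n/n≡m h 2)
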